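{- Let $G$ be a connected graph such that $\alpha(G_{SR})=2$, and let $\{w_1,w_2\}$ be a vertex cover of $G_{SR}$. Then $w_1$ and $w_2$ have at most one common neighbour in $G_{SR}$.
   Context: For vertices $u,v$ of a connected graph $G$, $v$ is maximally distant from $u$ if $d(u,x)\le d(u,v)$ for every neighbour $x$ of $v$; $u$ and $v$ are mutually maximally distant (MMD) if each is maximally distant from the other. The strong resolving graph $G_{SR}$ has vertex set $V(G)$, with $u,v$ adjacent iff $u$ and $v$ are MMD in $G$. $\alpha(H)$ is the vertex covering number of $H$ (minimum size of a set of vertices meeting every edge). -}

module Defs where

open import Data.Nat using (ℕ; zero; suc; _≤_)
open import Data.Fin using (Fin)
open import Data.Fin.Subset using (Subset; _∈_; ∣_∣; ⁅_⁆; _∪_)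
open import Data.Product using (_×_; ∃)
open import Data.Sum using (_⊎_)
open import Relation.Binary.PropositionalEquality using (_≡_; _≢_)
open import Relation.Nullary using (¬_)

record Graph (n : ℕ) : Set₁ where
  field
    Adj   : Fin n → Fin n → Set
    sym   : ∀ {u v} → Adj u v → Adj v u
    irrefl : ∀ {u} → ¬ Adj u u
open Graph public

data Walk {n : ℕ} (G : Graph n) : Fin n → Fin n → ℕ → Set where
  here : ∀ {u} → Walk G u u zero
  step : ∀ {u w v k} → Adj G u w → Walk G w v k → Walk G u v (suc k)

Connected : ∀ {n} → Graph n → Set
Connected G = ∀ u v → ∃ λ k → Walk G u v k

Dist : ∀ {n} → Graph n → Fin n → Fin n → ℕ → Set
Dist G u v k = Walk G u v k × (∀ m → Walk G u v m → k ≤ m)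

MaxDist : ∀ {n} → Graph n → Fin n → Fin n → Set
MaxDist G u v = ∀ x → Adj G v x → ∀ a b → Dist G u x a → Dist G u v b → a ≤ b

MMD : ∀ {n} → Graph n → Fin n → Fin n → Set
MMD G u v = MaxDist G u v × MaxDist G v u

-- Adjacency of the strong resolving graph G_SR (a simple graph, so u ≠ v).
SRAdj : ∀ {n} → Graph n → Fin n → Fin n → Set
SRAdj G u v = u ≢ v × MMD G u v

IsVertexCover : ∀ {n} → (Fin n → Fin n → Set) → Subset n → Set
IsVertexCover H S = ∀ u v → H u v → u ∈ S ⊎ v ∈ S

VertexCoverNumber : ∀ {n} → (Fin n → Fin n → Set) → ℕ → Set
VertexCoverNumber H k =
  (∃ λ S → IsVertexCover H S × ∣ S ∣ ≡ k) × (∀ S → IsVertexCover H S → k ≤ ∣ S ∣)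

module Submission where

-- In fact no vertex
-- cover S of G_SR can consist of vertices that are all MMD with both of two
-- distinct vertices x and y.
--
-- Start from the pair (x, y) and repeatedly push one endpoint of the
-- pair one step farther from the other, keeping the invariant that
-- p – x – y – q is a geodesic.  Distances are bounded, so this stops at a
-- mutually maximally distant pair (p, q), i.e. an edge of G_SR.  One endpoint
-- lies in S, say p = w; then w – x – y is a geodesic, which is impossible as
-- x is maximally distant from w: the neighbour of x one step closer to y
-- would be farther from w than x.
--
-- Adjacency is not decidable, so the argument runs under double negation;
-- the goal x ≡ y is decidable, so this costs nothing at the end.

open import Defs hiding (sym)
open import Data.Nat using (ℕ; zero; suc; _+_; _≤_; _<_; s≤s)
open import Data.Nat.Properties
  using (≤-reflexive; ≤-trans; ≤-antisym; <-irrefl; ≮⇒≥; <⇒≱; n≤0⇒n≡0;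
         n≢0⇒n>0; m≤m+n; m≤n+m; +-comm; +-assoc; +-suc; +-identityʳ;
         +-monoˡ-≤; +-monoʳ-<; +-cancelʳ-≤; +-0-commutativeMonoid;
         module ≤-Reasoning)
open import Data.Nat.Induction using (<-rec)
open import Algebra.Properties.CommutativeMonoid.Sum +-0-commutativeMonoid
  using (sum; sum-remove)
open import Data.Fin using (Fin; zero; suc; _≟_)
open import Data.Fin.Subset using (Subset; _∈_; ⁅_⁆; _∪_)
open import Data.Fin.Subset.Properties using (x∈p∪q⁻; x∈⁅y⁆⇒x≡y)
open import Data.Product using (_×_; _,_; proj₁; proj₂; ∃; ∃₂)
open import Data.Sum using (_⊎_; inj₁; inj₂)
open import Data.Empty using (⊥; ⊥-elim)
open import Function using (_∘_)
open import Relation.Nullary using (¬_; yes; no)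
open import Relation.Nullary.Decidable using (¬¬-excluded-middle)
open import Relation.Binary.PropositionalEquality
  using (_≡_; _≢_; refl; sym; subst; subst₂; cong; cong₂; module ≡-Reasoning)

¬¬-∀-Fin : ∀ {n} {P : Fin n → Set} → (∀ i → ¬ ¬ P i) → ¬ ¬ (∀ i → P i)
¬¬-∀-Fin {zero}  _ k = k (λ ())
¬¬-∀-Fin {suc n} {P} h k =
  h zero λ p₀ → ¬¬-∀-Fin {P = P ∘ suc} (h ∘ suc) λ ps →
    k λ { zero → p₀ ; (suc i) → ps i }

entry≤sum : ∀ {k} (t : Fin k → ℕ) i → t i ≤ sum t
entry≤sum {suc _} t i = subst (t i ≤_) (sym (sum-remove t)) (m≤m+n (t i) _)

module Walks {n} (G : Graph n) where

  snoc : ∀ {u v w k} → Walk G u v k → Adj G v w → Walk G u w (suc k)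
  snoc here       e′ = step e′ here
  snoc (step e p) e′ = step e (snoc p e′)

  reverse : ∀ {u v k} → Walk G u v k → Walk G v u k
  reverse here       = here
  reverse (step e p) = snoc (reverse p) (Graph.sym G e)

  _++ʷ_ : ∀ {u v w k m} → Walk G u v k → Walk G v w m → Walk G u w (k + m)
  here     ++ʷ q = q
  step e p ++ʷ q = step e (p ++ʷ q)

  walk-zero : ∀ {u v} → Walk G u v zero → u ≡ v
  walk-zero here = refl

  shortest-walk : ∀ {u v} k → Walk G u v k → ¬ ¬ ∃ (Dist G u v)
  shortest-walk {u} {v} = <-rec _ shorten
    where
    Shorter : ℕ → Set
    Shorter k = ∃ λ m → m < k × Walk G u v m

    shorten : ∀ k → (∀ {m} → m < k → Walk G u v m → ¬ ¬ ∃ (Dist G u v)) →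
              Walk G u v k → ¬ ¬ ∃ (Dist G u v)
    shorten k rec w ¬D = ¬¬-excluded-middle {A = Shorter k} λ
      { (yes (m , m<k , w′)) → rec m<k w′ ¬D
      ; (no ¬shorter)        →
          ¬D (k , w , λ m w′ → ≮⇒≥ λ m<k → ¬shorter (m , m<k , w′)) }

  distances : Connected G → ¬ ¬ (∀ u v → ∃ (Dist G u v))
  distances conn =
    ¬¬-∀-Fin λ u → ¬¬-∀-Fin λ v → shortest-walk _ (proj₂ (conn u v))

module Metric {n} (G : Graph n) (d : Fin n → Fin n → ℕ)
              (dist : ∀ u v → Dist G u v (d u v)) where
  open Walks G

  d-minimal : ∀ {u v k} → Walk G u v k → d u v ≤ k
  d-minimal w = proj₂ (dist _ _) _ w

  d-unique : ∀ {u v a} → Dist G u v a → a ≡ d u v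
  d-unique D = ≤-antisym (proj₂ D _ (proj₁ (dist _ _))) (d-minimal (proj₁ D))

  d-sym : ∀ u v → d u v ≡ d v u
  d-sym u v = ≤-antisym (d-minimal (reverse (proj₁ (dist v u))))
                        (d-minimal (reverse (proj₁ (dist u v))))

  d-triangle : ∀ u v w → d u w ≤ d u v + d v w
  d-triangle u v w = d-minimal (proj₁ (dist u v) ++ʷ proj₁ (dist v w))

  d-adj : ∀ {u v} → Adj G u v → d u v ≤ 1
  d-adj e = d-minimal (step e here)

  d-self : ∀ u → d u u ≡ 0
  d-self u = n≤0⇒n≡0 (d-minimal here)

  d-pos : ∀ {u v} → u ≢ v → 0 < d u v
  d-pos {u} {v} u≢v = n≢0⇒n>0 λ d≡0 →
    u≢v (walk-zero (subst (Walk G u v) d≡0 (proj₁ (dist u v))))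

  geodesic-step : ∀ {a b} → 0 < d a b → ∃ λ a₁ → Adj G a a₁ × d a₁ b < d a b
  geodesic-step {a} {b} = first-step (proj₁ (dist a b)) refl
    where
    first-step : ∀ {k} → Walk G a b k → k ≡ d a b → 0 < k →
                 ∃ λ a₁ → Adj G a a₁ × d a₁ b < d a b
    first-step (step {w = a₁} e rest) k≡d _ =
      a₁ , e , subst (d a₁ b <_) k≡d (s≤s (d-minimal rest))
    first-step here _ ()

  MaxDistFrom : Fin n → Fin n → Set
  MaxDistFrom u v = ∀ z → Adj G v z → d u z ≤ d u v

  maxDist⇒ : ∀ {u v} → MaxDist G u v → MaxDistFrom u v
  maxDist⇒ h z e = h z e _ _ (dist _ _) (dist _ _)

  ⇒maxDist : ∀ {u v} → MaxDistFrom u v → MaxDist G u v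
  ⇒maxDist h z e a b Da Db =
    subst₂ _≤_ (sym (d-unique Da)) (sym (d-unique Db)) (h z e)

  maximal-blocks-geodesic : ∀ {w a b} → MaxDistFrom w a → a ≢ b →
                            ¬ (d w a + d a b ≤ d w b)
  maximal-blocks-geodesic {w} {a} {b} md a≢b geodesic
    with geodesic-step (d-pos a≢b)
  ... | a₁ , e , closer = <-irrefl refl (begin-strict
    d w b            ≤⟨ d-triangle w a₁ b ⟩
    d w a₁ + d a₁ b  ≤⟨ +-monoˡ-≤ (d a₁ b) (md a₁ e) ⟩
    d w a + d a₁ b   <⟨ +-monoʳ-< (d w a) closer ⟩
    d w a + d a b    ≤⟨ geodesic ⟩
    d w b            ∎)
    where open ≤-Reasoning

  bound : ℕ
  bound = sum λ u → sum λ v → d u v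

  d≤bound : ∀ u v → d u v ≤ bound
  d≤bound u v = ≤-trans (entry≤sum (d u) v) (entry≤sum (λ u → sum (d u)) u)

  mmd-extension :
    (P : Fin n → Fin n → Set) →
    (∀ {p q z} → P p q → Adj G p z → d q p < d q z → P z q) →
    (∀ {p q z} → P p q → Adj G q z → d p q < d p z → P p z) →
    ∀ {p q} → P p q →
    ¬ ¬ (∃₂ λ p q → P p q × MaxDistFrom p q × MaxDistFrom q p)
  mmd-extension P push-p push-q {p} {q} Ppq =
    climb (suc bound) Ppq (m≤n+m (suc bound) (d p q))
    where
    -- Pushing increases d p q, so the fuel needed to exceed bound drops.
    raise : ∀ {a b} f → a < b → bound < a + suc f → bound < b + f
    raise {a} {b} f a<b bound<a = ≤-trans bound<a
      (subst (_≤ b + f) (sym (+-suc a f)) (+-monoˡ-≤ f a<b))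

    -- Invariant: bound < d p q + fuel, which fails once fuel runs out.
    climb : ∀ fuel {p q} → P p q → bound < d p q + fuel →
            ¬ ¬ (∃₂ λ p q → P p q × MaxDistFrom p q × MaxDistFrom q p)
    climb zero {p} {q} _ bound<d _ =
      <⇒≱ (subst (bound <_) (+-identityʳ (d p q)) bound<d) (d≤bound p q)
    climb (suc f) {p} {q} Ppq bound<d k =
      ¬¬-excluded-middle {A = ∃ λ z → Adj G p z × d q p < d q z} λ
      { (yes (z , e , farther)) →
          climb f (push-p Ppq e farther)
            (raise f (subst₂ _<_ (d-sym q p) (d-sym q z) farther) bound<d) k
      ; (no stuck-p) →
          ¬¬-excluded-middle {A = ∃ λ z → Adj G q z × d p q < d p z} λ
          { (yes (z , e , farther)) →
              climb f (push-q Ppq e farther) (raise f farther bound<d) k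
          ; (no stuck-q) → k (p , q , Ppq
              , (λ z e → ≮⇒≥ λ lt → stuck-q (z , e , lt))
              , (λ z e → ≮⇒≥ λ lt → stuck-p (z , e , lt))) } }

  Through : Fin n → Fin n → Fin n → Fin n → Set
  Through x y p q = d p x + d x y + d y q ≤ d p q

  through-start : ∀ x y → Through x y x y
  through-start x y = ≤-reflexive (begin
    d x x + d x y + d y y  ≡⟨ cong₂ (λ a b → a + d x y + b) (d-self x) (d-self y) ⟩
    d x y + 0              ≡⟨ +-identityʳ (d x y) ⟩
    d x y                  ∎)
    where open ≡-Reasoning

  through-reverse : ∀ {x y p q} → Through x y p q → Through y x q p
  through-reverse {x} {y} {p} {q} t = subst₂ _≤_ reversed (d-sym p q) t
    where
    open ≡-Reasoning
    reversed : d p x + d x y + d y q ≡ d q y + d y x + d x p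
    reversed = begin
      d p x + d x y + d y q  ≡⟨ +-comm (d p x + d x y) (d y q) ⟩
      d y q + (d p x + d x y) ≡⟨ cong (d y q +_) (+-comm (d p x) (d x y)) ⟩
      d y q + (d x y + d p x) ≡⟨ +-assoc (d y q) (d x y) (d p x) ⟨
      d y q + d x y + d p x  ≡⟨ cong₂ (λ a b → a + b + d p x) (d-sym y q) (d-sym x y) ⟩
      d q y + d y x + d p x  ≡⟨ cong (d q y + d y x +_) (d-sym p x) ⟩
      d q y + d y x + d x p  ∎

  through-push : ∀ {x y p q z} → Through x y p q → Adj G p z →
                 d q p < d q z → Through x y z q
  through-push {x} {y} {p} {q} {z} t e farther = begin
    d z x + d x y + d y q        ≤⟨ +-monoˡ-≤ (d y q) (+-monoˡ-≤ (d x y) z-near-x) ⟩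
    suc (d p x + d x y + d y q)  ≤⟨ s≤s t ⟩
    suc (d p q)                  ≡⟨ cong suc (d-sym p q) ⟩
    suc (d q p)                  ≤⟨ farther ⟩
    d q z                        ≡⟨ d-sym q z ⟩
    d z q                        ∎
    where
    open ≤-Reasoning
    z-near-x : d z x ≤ suc (d p x)
    z-near-x = ≤-trans (d-triangle z p x)
                       (+-monoˡ-≤ (d p x) (d-adj (Graph.sym G e)))

  through-push′ : ∀ {x y p q z} → Through x y p q → Adj G q z →
                  d p q < d p z → Through x y p z
  through-push′ t e farther =
    through-reverse (through-push (through-reverse t) e farther)

  through-distinct : ∀ {x y p q} → x ≢ y → Through x y p q → p ≢ q
  through-distinct {x} {y} {p} x≢y t refl = <⇒≱ (d-pos x≢y) (begin
    d x y                  ≤⟨ m≤n+m (d x y) (d p x) ⟩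
    d p x + d x y          ≤⟨ m≤m+n (d p x + d x y) (d y p) ⟩
    d p x + d x y + d y p  ≤⟨ t ⟩
    d p p                  ≡⟨ d-self p ⟩
    0                      ∎)
    where open ≤-Reasoning

  through-blocked : ∀ {x y w q} → x ≢ y → MaxDistFrom w x → ¬ Through x y w q
  through-blocked {x} {y} {w} {q} x≢y md t =
    maximal-blocks-geodesic md x≢y
      (+-cancelʳ-≤ (d y q) _ _ (≤-trans t (d-triangle w y q)))

  cover-of-common-neighbours : ∀ {x y} {S : Subset n} → x ≢ y →
    IsVertexCover (SRAdj G) S →
    (∀ {w} → w ∈ S → SRAdj G w x × SRAdj G w y) → ⊥
  cover-of-common-neighbours {x} {y} {S} x≢y cover sees =
    mmd-extension (Through x y) through-push through-push′ (through-start x y)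
      λ (p , q , t , q-far , p-far) →
        blocked-endpoint (cover p q (through-distinct x≢y t
                                    , ⇒maxDist q-far , ⇒maxDist p-far)) t
    where
    far : ∀ {w v} → SRAdj G w v → MaxDistFrom w v
    far = maxDist⇒ ∘ proj₁ ∘ proj₂

    blocked-endpoint : ∀ {p q} → p ∈ S ⊎ q ∈ S → ¬ Through x y p q
    blocked-endpoint (inj₁ p∈S) t =
      through-blocked x≢y (far (proj₁ (sees p∈S))) t
    blocked-endpoint (inj₂ q∈S) t =
      through-blocked (x≢y ∘ sym) (far (proj₂ (sees q∈S))) (through-reverse t)

∈-pair : ∀ {n} {w₁ w₂ u : Fin n} → u ∈ ⁅ w₁ ⁆ ∪ ⁅ w₂ ⁆ → u ≡ w₁ ⊎ u ≡ w₂
∈-pair {w₁ = w₁} {w₂} u∈S with x∈p∪q⁻ ⁅ w₁ ⁆ ⁅ w₂ ⁆ u∈S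
... | inj₁ u∈₁ = inj₁ (x∈⁅y⁆⇒x≡y w₁ u∈₁)
... | inj₂ u∈₂ = inj₂ (x∈⁅y⁆⇒x≡y w₂ u∈₂)

lemma4p1 : ∀ {n} (G : Graph n) → Connected G →
    VertexCoverNumber (SRAdj G) 2 →
    (w₁ w₂ : Fin n) → w₁ ≢ w₂ → IsVertexCover (SRAdj G) (⁅ w₁ ⁆ ∪ ⁅ w₂ ⁆) →
    ∀ x y → SRAdj G w₁ x → SRAdj G w₂ x → SRAdj G w₁ y → SRAdj G w₂ y → x ≡ y
lemma4p1 G conn _ w₁ w₂ _ cover x y h₁x h₂x h₁y h₂y with x ≟ y
... | yes x≡y = x≡y
... | no x≢y  = ⊥-elim (Walks.distances G conn λ D →
      Metric.cover-of-common-neighbours G (λ u v → proj₁ (D u v))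
        (λ u v → proj₂ (D u v)) x≢y cover sees)
  where
  sees : ∀ {w} → w ∈ ⁅ w₁ ⁆ ∪ ⁅ w₂ ⁆ → SRAdj G w x × SRAdj G w y
  sees w∈S with ∈-pair w∈S
  ... | inj₁ refl = h₁x , h₁y
  ... | inj₂ refl = h₂x , h₂y
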